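{- Let $C,D$ be non-negative integers, $M$ a one-tape NTM with $q$ states, and $w$ an input for $M$ of length $n$. Assume that on some computation $\zeta$ on input $w$, $M$ makes at least $t$ steps, where $t\le Cn+D$, and that each crossing sequence among $\mathcal C_1^t(M,\zeta,w),\dots,\mathcal C_n^t(M,\zeta,w)$ appears at most $k$ times in this list. Then $n\le D+4kq^C$.
   Context: A one-tape NTM is $M=(Q,\Sigma,\Gamma,\sqcup,\delta,q_0,q_{acc},q_{rej})$ with $\delta:(Q\setminus\{q_{acc},q_{rej}\})\times\Gamma\to\mathcal P(Q\times\Gamma\times\{ -1,1\})\setminus\{\emptyset\}$, $q_0,q_{acc},q_{rej}$ pairwise distinct; the head moves on every step. Tape cells are numbered by integers, $M$ starts on cell $0$, input $w$ has its $i$-th symbol in cell $i-1$; boundary $i$ lies between cells $i-1$ and $i$. If in the first $t$ steps of computation $\zeta$ on $w$ the head crosses boundary $i$ at steps $t_1<t_2<\dots$ and $M$ is in state $q_j$ after step $t_j$, the crossing sequence is $\mathcal C_i^t(M,\zeta,w)=(q_1,q_2,\dots)$. -}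

module Defs where

open import Data.Nat using (ℕ; zero; suc; _+_; _*_; _^_; _≤_; _<?_)
open import Data.Integer as ℤ using (ℤ; +_; -[1+_])
open import Data.Fin as Fin using (Fin)
open import Data.List using (List; []; _∷_; _++_; [_]; length; filter; map)
import Data.List.Properties as LP
open import Data.Bool using (Bool; true; false; _∧_; _∨_; if_then_else_)
open import Data.Product using (Σ; _×_; _,_; ∃)
open import Relation.Binary.PropositionalEquality using (_≡_; _≢_)
open import Relation.Nullary using (¬_; does)
open import Function.Definitions using (Injective)

data Dir : Set where
  L R : Dir

move : Dir → ℤ
move L = -[1+ 0 ]
move R = + 1

-- The transition function δ : (Q∖{acc,rej}) × Γ → P(Q × Γ × {-1,1}) ∖ {∅}
-- is given as a relation (δ p a p' b d means (p',b,d) ∈ δ(p,a)),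
-- which is required to be nonempty on non-halting states.
record NTM : Set₁ where
  field
    q σ γ   : ℕ
    ι       : Fin σ → Fin γ
    ι-inj   : Injective _≡_ _≡_ ι
    blank   : Fin γ
    blank∉Σ : ∀ a → ι a ≢ blank
    δ       : Fin q → Fin γ → Fin q → Fin γ → Dir → Set
    q₀ qacc qrej : Fin q
    q₀≢acc  : q₀ ≢ qacc
    q₀≢rej  : q₀ ≢ qrej
    acc≢rej : qacc ≢ qrej
    δ-nonempty : ∀ p a → p ≢ qacc → p ≢ qrej →
                 Σ (Fin q) λ p' → Σ (Fin γ) λ b → Σ Dir λ d → δ p a p' b d

module _ (M : NTM) where
  open NTM M

  record Config : Set where
    constructor config
    field
      state : Fin q
      head  : ℤ
      tape  : ℤ → Fin γ

  open Config public

  nth : {A : Set} → List A → ℕ → A → A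
  nth []       _       d = d
  nth (x ∷ xs) zero    d = x
  nth (x ∷ xs) (suc i) d = nth xs i d

  -- initial tape: the i-th input symbol (1-based) in cell i-1, blanks elsewhere
  initTape : List (Fin σ) → ℤ → Fin γ
  initTape w (+ m)    = nth (map ι w) m blank
  initTape w -[1+ m ] = blank

  initConfig : List (Fin σ) → Config
  initConfig w = config q₀ (+ 0) (initTape w)

  Step : Config → Config → Set
  Step c c' =
    state c ≢ qacc × state c ≢ qrej ×
    Σ Dir λ d →
      δ (state c) (tape c (head c)) (state c') (tape c' (head c)) d ×
      head c' ≡ head c ℤ.+ move d ×
      (∀ j → j ≢ head c → tape c' j ≡ tape c j)

  -- ζ is (a prefix of) a computation of M on w making at least t steps
  IsRun : List (Fin σ) → ℕ → (ℕ → Config) → Set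
  IsRun w t ζ = (ζ 0 ≡ initConfig w) × (∀ s → suc s ≤ t → Step (ζ s) (ζ (suc s)))

  _==ℤ_ : ℤ → ℤ → Bool
  x ==ℤ y = does (x ℤ.≟ y)

  -- does the head cross boundary i (between cells i-1 and i) at step s+1?
  crossesAt : (ℕ → Config) → ℤ → ℕ → Bool
  crossesAt ζ i s =
    ((head (ζ s) ==ℤ (i ℤ.- + 1)) ∧ (head (ζ (suc s)) ==ℤ i)) ∨
    ((head (ζ s) ==ℤ i) ∧ (head (ζ (suc s)) ==ℤ (i ℤ.- + 1)))

  crossingSeq : (ℕ → Config) → ℕ → ℤ → List (Fin q)
  crossingSeq ζ zero    i = []
  crossingSeq ζ (suc s) i =
    crossingSeq ζ s i ++
      (if crossesAt ζ i s then [ state (ζ (suc s)) ] else [])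

  crossingSeqs : (ℕ → Config) → ℕ → ℕ → List (List (Fin q))
  crossingSeqs ζ t n = go n
    where
    go : ℕ → List (List (Fin q))
    go zero    = []
    go (suc m) = go m ++ [ crossingSeq ζ t (+ suc m) ]

  occurrences : List (Fin q) → List (List (Fin q)) → ℕ
  occurrences c cs = length (filter (λ c' → LP.≡-dec Fin._≟_ c' c) cs)

-- Let c₁, …, cₙ be the crossing sequences of the boundaries 1, …, n during the
-- first t steps, and call  deficit C c = (C + 1) ∸ |c|  the amount by which a
-- word c falls short of having length > C.  Always  C + 1 ≤ |c| + deficit C c,
-- so summing over the n boundaries gives
--     n (C + 1)  ≤  ∑ |cᵢ|  +  ∑ deficit C cᵢ.
-- (1) A single move crosses at most one boundary, so ∑ |cᵢ| ≤ t ≤ Cn + D.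
-- (2) Only words of length ≤ C have positive deficit; there are at most 2q^C of
--     them when q ≥ 2, their total deficit is at most 4q^C, and by double
--     counting each contributes at most k times, so ∑ deficit C cᵢ ≤ 4kq^C.
-- Cancelling Cn gives n ≤ D + 4kq^C.  The argument only counts crossings.
module Submission where

open import Defs
open import Data.Nat using (ℕ; _+_; _*_; _^_; _≤_)
open import Data.Integer using (+_)
open import Data.List using (List; length)
open import Data.Fin using (Fin)

open import Data.Nat using (zero; suc; _∸_; z≤n; s≤s)
open import Data.Nat.Properties
open import Data.Nat.ListAction using (sum)
open import Data.Nat.ListAction.Properties using (sum-++)
import Data.Fin as Fin
import Data.Integer as ℤ
import Data.Integer.Properties as ℤP
import Data.Integer.Tactic.RingSolver as ℤ-Solver
open import Data.List using ([]; _∷_; _++_; [_]; map; filter; allFin; cartesianProductWith)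
import Data.List.Properties as LP
open import Data.List.Membership.Propositional using (_∈_)
open import Data.List.Membership.Propositional.Properties
  using (∈-++⁺ˡ; ∈-++⁺ʳ; ∈-++⁻; ∈-map⁻; ∈-allFin; ∈-cartesianProductWith⁺; ∈-cartesianProductWith⁻)
open import Data.List.Relation.Unary.Any using (here; there)
open import Data.List.Relation.Unary.All as All using (All; _∷_)
open import Data.Bool using (Bool; true; false; T; _∧_; if_then_else_)
open import Data.Bool.Properties using (T-∨)
open import Data.Unit using (tt)
open import Data.Product using (∃; _×_; _,_)
open import Data.Sum as Sum using (_⊎_; inj₁; inj₂)
open import Data.Empty using (⊥-elim)
open import Function using (_∘_; Equivalence)
open import Relation.Nullary using (does; yes; no)
open import Relation.Binary.Definitions using (DecidableEquality)
open import Relation.Binary.PropositionalEquality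
  using (_≡_; _≢_; refl; sym; trans; cong; cong₂; subst; module ≡-Reasoning)
open import Algebra.Properties.CommutativeSemigroup +-commutativeSemigroup
  using (interchange)

open Equivalence using (to)

indicator : Bool → ℕ
indicator true  = 1
indicator false = 0

∑ : {A : Set} → (A → ℕ) → List A → ℕ
∑ f xs = sum (map f xs)

module _ {A : Set} where

  ∑-++ : ∀ (f : A → ℕ) xs ys → ∑ f (xs ++ ys) ≡ ∑ f xs + ∑ f ys
  ∑-++ f xs ys = trans (cong sum (LP.map-++ f xs ys)) (sum-++ (map f xs) (map f ys))

  ∑-+ : ∀ (f g : A → ℕ) xs → ∑ (λ x → f x + g x) xs ≡ ∑ f xs + ∑ g xs
  ∑-+ f g []       = refl
  ∑-+ f g (x ∷ xs) =
    trans (cong (_+_ (f x + g x)) (∑-+ f g xs)) (interchange (f x) (g x) (∑ f xs) (∑ g xs))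

  ∑-*ʳ : ∀ (f : A → ℕ) k xs → ∑ (λ x → f x * k) xs ≡ ∑ f xs * k
  ∑-*ʳ f k []       = refl
  ∑-*ʳ f k (x ∷ xs) =
    trans (cong (_+_ (f x * k)) (∑-*ʳ f k xs)) (sym (*-distribʳ-+ k (f x) (∑ f xs)))

  ∑-const : ∀ c (xs : List A) → ∑ (λ _ → c) xs ≡ length xs * c
  ∑-const c []       = refl
  ∑-const c (x ∷ xs) = cong (_+_ c) (∑-const c xs)

  ∑-zero : ∀ (xs : List A) → ∑ (λ _ → 0) xs ≡ 0
  ∑-zero []       = refl
  ∑-zero (x ∷ xs) = ∑-zero xs

  ∑-mono : ∀ {f g : A → ℕ} xs → (∀ x → x ∈ xs → f x ≤ g x) → ∑ f xs ≤ ∑ g xs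
  ∑-mono []       _   = z≤n
  ∑-mono (x ∷ xs) f≤g = +-mono-≤ (f≤g x (here refl)) (∑-mono xs (λ y y∈ → f≤g y (there y∈)))

∑-map : ∀ {A B : Set} (f : B → ℕ) (g : A → B) xs → ∑ f (map g xs) ≡ ∑ (f ∘ g) xs
∑-map f g xs = cong sum (sym (LP.map-∘ xs))

module Multiplicity {A : Set} (_≟_ : DecidableEquality A) where

  count : A → List A → ℕ
  count a xs = length (filter (λ x → x ≟ a) xs)

  ⟦_≐_⟧ : A → A → ℕ
  ⟦ x ≐ a ⟧ = indicator (does (x ≟ a))

  count-∷ : ∀ a x xs → count a (x ∷ xs) ≡ ⟦ x ≐ a ⟧ + count a xs
  count-∷ a x xs with does (x ≟ a)
  ... | true  = refl
  ... | false = refl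

  count≡0⊎∈ : ∀ a xs → count a xs ≡ 0 ⊎ a ∈ xs
  count≡0⊎∈ a []       = inj₁ refl
  count≡0⊎∈ a (x ∷ xs) with x ≟ a | count≡0⊎∈ a xs
  ... | yes x≡a | _        = inj₂ (here (sym x≡a))
  ... | no _    | inj₁ c≡0 = inj₁ c≡0
  ... | no _    | inj₂ a∈  = inj₂ (there a∈)

  ≤-∑-⟦≐⟧ : ∀ (h : A → ℕ) {x} E → x ∈ E → h x ≤ ∑ (λ a → h a * ⟦ x ≐ a ⟧) E
  ≤-∑-⟦≐⟧ h {x} (a ∷ E) (here refl) with x ≟ x
  ... | yes _   = ≤-trans (≤-reflexive (sym (*-identityʳ (h x)))) (m≤m+n _ _)
  ... | no x≢x = ⊥-elim (x≢x refl)
  ≤-∑-⟦≐⟧ h (a ∷ E) (there x∈E) = ≤-trans (≤-∑-⟦≐⟧ h E x∈E) (m≤n+m _ _)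

  ∑-by-multiplicity : ∀ (h : A → ℕ) E xs → (∀ x → x ∈ xs → x ∈ E ⊎ h x ≡ 0) →
    ∑ h xs ≤ ∑ (λ a → h a * count a xs) E
  ∑-by-multiplicity h E []       _       = z≤n
  ∑-by-multiplicity h E (x ∷ xs) support = begin
    h x + ∑ h xs
      ≤⟨ +-mono-≤ hx≤ (∑-by-multiplicity h E xs (λ y y∈ → support y (there y∈))) ⟩
    ∑ (λ a → h a * ⟦ x ≐ a ⟧) E + ∑ (λ a → h a * count a xs) E
      ≡⟨ ∑-+ (λ a → h a * ⟦ x ≐ a ⟧) (λ a → h a * count a xs) E ⟨
    ∑ (λ a → h a * ⟦ x ≐ a ⟧ + h a * count a xs) E
      ≤⟨ ∑-mono E (λ a _ → ≤-reflexive (multiplicity-step a)) ⟩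
    ∑ (λ a → h a * count a (x ∷ xs)) E ∎
    where
    open ≤-Reasoning
    hx≤ : h x ≤ ∑ (λ a → h a * ⟦ x ≐ a ⟧) E
    hx≤ with support x (here refl)
    ... | inj₁ x∈E  = ≤-∑-⟦≐⟧ h E x∈E
    ... | inj₂ hx≡0 = subst (_≤ ∑ (λ a → h a * ⟦ x ≐ a ⟧) E) (sym hx≡0) z≤n
    multiplicity-step : ∀ a → h a * ⟦ x ≐ a ⟧ + h a * count a xs ≡ h a * count a (x ∷ xs)
    multiplicity-step a =
      trans (sym (*-distribˡ-+ (h a) ⟦ x ≐ a ⟧ (count a xs))) (cong (h a *_) (sym (count-∷ a x xs)))

length-cartesianProductWith : ∀ {A B C : Set} (f : A → B → C) xs ys →
  length (cartesianProductWith f xs ys) ≡ length xs * length ys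
length-cartesianProductWith f []       ys = refl
length-cartesianProductWith f (x ∷ xs) ys = begin
  length (map (f x) ys ++ cartesianProductWith f xs ys)
    ≡⟨ LP.length-++ (map (f x) ys) ⟩
  length (map (f x) ys) + length (cartesianProductWith f xs ys)
    ≡⟨ cong₂ _+_ (LP.length-map (f x) ys) (length-cartesianProductWith f xs ys) ⟩
  length ys + length xs * length ys ∎
  where open ≡-Reasoning

deficit : {A : Set} → ℕ → List A → ℕ
deficit C c = suc C ∸ length c

length-plus-deficit : ∀ {A : Set} C (cs : List (List A)) →
  length cs * suc C ≤ ∑ length cs + ∑ (deficit C) cs
length-plus-deficit C cs = begin
  length cs * suc C                       ≡⟨ ∑-const (suc C) cs ⟨
  ∑ (λ _ → suc C) cs                      ≤⟨ ∑-mono cs (λ c _ → m≤n+m∸n (suc C) (length c)) ⟩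
  ∑ (λ c → length c + deficit C c) cs     ≡⟨ ∑-+ length (deficit C) cs ⟩
  ∑ length cs + ∑ (deficit C) cs ∎
  where open ≤-Reasoning

module Words {A : Set} (as : List A) where

  words : ℕ → List (List A)
  words zero    = [ [] ]
  words (suc j) = cartesianProductWith _∷_ as (words j)

  wordsUpTo : ℕ → List (List A)
  wordsUpTo zero    = words zero
  wordsUpTo (suc C) = wordsUpTo C ++ words (suc C)

  length-words : ∀ j → length (words j) ≡ length as ^ j
  length-words zero    = refl
  length-words (suc j) =
    trans (length-cartesianProductWith _∷_ as (words j)) (cong (length as *_) (length-words j))

  words-length : ∀ j {c} → c ∈ words j → length c ≡ j
  words-length zero    (here refl) = refl
  words-length (suc j) c∈ with ∈-cartesianProductWith⁻ _∷_ as (words j) c∈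
  ... | _ , c′ , _ , c′∈ , refl = cong suc (words-length j c′∈)

  ∈-words : ∀ {c} → All (_∈ as) c → c ∈ words (length c)
  ∈-words All.[]         = here refl
  ∈-words (x∈as ∷ c∈as) = ∈-cartesianProductWith⁺ _∷_ x∈as (∈-words c∈as)

  wordsUpTo-length : ∀ C {c} → c ∈ wordsUpTo C → length c ≤ C
  wordsUpTo-length zero    c∈ = ≤-reflexive (words-length zero c∈)
  wordsUpTo-length (suc C) c∈ with ∈-++⁻ (wordsUpTo C) c∈
  ... | inj₁ c∈upTo = m≤n⇒m≤1+n (wordsUpTo-length C c∈upTo)
  ... | inj₂ c∈len  = ≤-reflexive (words-length (suc C) c∈len)

  ∈-wordsUpTo : ∀ C {c} → All (_∈ as) c → length c ≤ C → c ∈ wordsUpTo C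
  ∈-wordsUpTo zero    c∈as |c|≤0 = subst (λ j → _ ∈ words j) (n≤0⇒n≡0 |c|≤0) (∈-words c∈as)
  ∈-wordsUpTo (suc C) c∈as |c|≤ with m≤n⇒m<n∨m≡n |c|≤
  ... | inj₁ (s≤s |c|≤C) = ∈-++⁺ˡ (∈-wordsUpTo C c∈as |c|≤C)
  ... | inj₂ |c|≡       = ∈-++⁺ʳ (wordsUpTo C) (subst (λ j → _ ∈ words j) |c|≡ (∈-words c∈as))

  -- Raising C by one adds one to the deficit of every word of length ≤ C and
  -- gives each word of length C + 1 deficit one, so the total deficit grows by
  -- the number of words of length ≤ C + 1.
  ∑-deficit-step : ∀ C →
    ∑ (deficit (suc C)) (wordsUpTo (suc C)) ≤ ∑ (deficit C) (wordsUpTo C) + length (wordsUpTo (suc C))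
  ∑-deficit-step C = begin
    ∑ (deficit (suc C)) (wordsUpTo C ++ words (suc C))
      ≡⟨ ∑-++ (deficit (suc C)) (wordsUpTo C) (words (suc C)) ⟩
    ∑ (deficit (suc C)) (wordsUpTo C) + ∑ (deficit (suc C)) (words (suc C))
      ≤⟨ +-mono-≤ (∑-mono (wordsUpTo C) old-deficit) (∑-mono (words (suc C)) new-deficit) ⟩
    ∑ (λ c → 1 + deficit C c) (wordsUpTo C) + ∑ (λ _ → 1) (words (suc C))
      ≡⟨ cong (_+ ∑ (λ _ → 1) (words (suc C))) (∑-+ (λ _ → 1) (deficit C) (wordsUpTo C)) ⟩
    (∑ (λ _ → 1) (wordsUpTo C) + ∑ (deficit C) (wordsUpTo C)) + ∑ (λ _ → 1) (words (suc C))
      ≡⟨ cong₂ (λ a b → (a + ∑ (deficit C) (wordsUpTo C)) + b) (∑-ones (wordsUpTo C)) (∑-ones (words (suc C))) ⟩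
    (length (wordsUpTo C) + ∑ (deficit C) (wordsUpTo C)) + length (words (suc C))
      ≡⟨ trans (cong (_+ length (words (suc C))) (+-comm (length (wordsUpTo C)) _))
                (+-assoc (∑ (deficit C) (wordsUpTo C)) (length (wordsUpTo C)) _) ⟩
    ∑ (deficit C) (wordsUpTo C) + (length (wordsUpTo C) + length (words (suc C)))
      ≡⟨ cong (_+_ _) (LP.length-++ (wordsUpTo C)) ⟨
    ∑ (deficit C) (wordsUpTo C) + length (wordsUpTo (suc C)) ∎
    where
    open ≤-Reasoning
    ∑-ones : ∀ (cs : List (List A)) → ∑ (λ _ → 1) cs ≡ length cs
    ∑-ones cs = trans (∑-const 1 cs) (*-identityʳ (length cs))
    old-deficit : ∀ c → c ∈ wordsUpTo C → deficit (suc C) c ≤ 1 + deficit C c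
    old-deficit c c∈ = ≤-reflexive (+-∸-assoc 1 (m≤n⇒m≤1+n (wordsUpTo-length C c∈)))
    new-deficit : ∀ c → c ∈ words (suc C) → deficit (suc C) c ≤ 1
    new-deficit c c∈ = ≤-reflexive
      (trans (cong (suc (suc C) ∸_) (words-length (suc C) c∈)) (m+n∸n≡m 1 (suc C)))

  module _ (2≤q : 2 ≤ length as) where

    private
      q : ℕ
      q = length as

    double≤ : ∀ C → 2 * q ^ C ≤ q ^ suc C
    double≤ C = *-monoˡ-≤ (q ^ C) 2≤q

    length-wordsUpTo : ∀ C → length (wordsUpTo C) ≤ 2 * q ^ C
    length-wordsUpTo zero    = s≤s z≤n
    length-wordsUpTo (suc C) = begin
      length (wordsUpTo C ++ words (suc C))        ≡⟨ LP.length-++ (wordsUpTo C) ⟩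
      length (wordsUpTo C) + length (words (suc C)) ≡⟨ cong (_+_ _) (length-words (suc C)) ⟩
      length (wordsUpTo C) + q ^ suc C             ≤⟨ +-monoˡ-≤ _ (≤-trans (length-wordsUpTo C) (double≤ C)) ⟩
      q ^ suc C + q ^ suc C                        ≡⟨ cong (_+_ (q ^ suc C)) (+-identityʳ (q ^ suc C)) ⟨
      2 * q ^ suc C ∎
      where open ≤-Reasoning

    ∑-deficit-wordsUpTo : ∀ C → ∑ (deficit C) (wordsUpTo C) ≤ 4 * q ^ C
    ∑-deficit-wordsUpTo zero    = s≤s z≤n
    ∑-deficit-wordsUpTo (suc C) = begin
      ∑ (deficit (suc C)) (wordsUpTo (suc C))                ≤⟨ ∑-deficit-step C ⟩
      ∑ (deficit C) (wordsUpTo C) + length (wordsUpTo (suc C))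
        ≤⟨ +-mono-≤ (∑-deficit-wordsUpTo C) (length-wordsUpTo (suc C)) ⟩
      4 * q ^ C + 2 * q ^ suc C                              ≡⟨ cong (_+ 2 * q ^ suc C) (*-assoc 2 2 (q ^ C)) ⟩
      2 * (2 * q ^ C) + 2 * q ^ suc C                        ≤⟨ +-monoˡ-≤ _ (*-monoʳ-≤ 2 (double≤ C)) ⟩
      2 * q ^ suc C + 2 * q ^ suc C                          ≡⟨ *-distribʳ-+ (q ^ suc C) 2 2 ⟨
      4 * q ^ suc C ∎
      where open ≤-Reasoning

-- Only words of length ≤ C have positive deficit, so by double
-- counting the total deficit is at most k times that of wordsUpTo C.
∑-deficit-bound : ∀ {A : Set} (_≟_ : DecidableEquality A) (as : List A) →
  2 ≤ length as → ∀ C k (cs : List (List A)) →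
  (∀ c → c ∈ cs → All (_∈ as) c) →
  (∀ c → c ∈ cs → Multiplicity.count (LP.≡-dec _≟_) c cs ≤ k) →
  ∑ (deficit C) cs ≤ 4 * k * length as ^ C
∑-deficit-bound _≟_ as 2≤q C k cs letters count≤ = begin
  ∑ (deficit C) cs
    ≤⟨ ∑-by-multiplicity (deficit C) (wordsUpTo C) cs short∈ ⟩
  ∑ (λ c → deficit C c * count c cs) (wordsUpTo C)
    ≤⟨ ∑-mono (wordsUpTo C) (λ c _ → *-monoʳ-≤ (deficit C c) (count≤k c)) ⟩
  ∑ (λ c → deficit C c * k) (wordsUpTo C)
    ≡⟨ ∑-*ʳ (deficit C) k (wordsUpTo C) ⟩
  ∑ (deficit C) (wordsUpTo C) * k
    ≤⟨ *-monoˡ-≤ k (∑-deficit-wordsUpTo 2≤q C) ⟩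
  4 * length as ^ C * k
    ≡⟨ *-assoc 4 (length as ^ C) k ⟩
  4 * (length as ^ C * k)
    ≡⟨ cong (4 *_) (*-comm (length as ^ C) k) ⟩
  4 * (k * length as ^ C)
    ≡⟨ *-assoc 4 k (length as ^ C) ⟨
  4 * k * length as ^ C ∎
  where
  open ≤-Reasoning
  open Words as
  open Multiplicity (LP.≡-dec _≟_)
  short∈ : ∀ c → c ∈ cs → c ∈ wordsUpTo C ⊎ deficit C c ≡ 0
  short∈ c c∈ with length c ≤? C
  ... | yes |c|≤C = inj₁ (∈-wordsUpTo C (letters c c∈) |c|≤C)
  ... | no  |c|≰C = inj₂ (m≤n⇒m∸n≡0 (≰⇒> |c|≰C))
  count≤k : ∀ c → count c cs ≤ k
  count≤k c with count≡0⊎∈ c cs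
  ... | inj₁ count≡0 = subst (_≤ k) (sym count≡0) z≤n
  ... | inj₂ c∈      = count≤ c c∈

∑-deficit-bound-Fin : ∀ {q} → 2 ≤ q → ∀ C k (cs : List (List (Fin q))) →
  (∀ c → c ∈ cs → Multiplicity.count (LP.≡-dec Fin._≟_) c cs ≤ k) →
  ∑ (deficit C) cs ≤ 4 * k * q ^ C
∑-deficit-bound-Fin {q} 2≤q C k cs count≤ =
  subst (λ m → ∑ (deficit C) cs ≤ 4 * k * m ^ C) length-allFin
    (∑-deficit-bound Fin._≟_ (allFin q) (subst (2 ≤_) (sym length-allFin) 2≤q) C k cs
                     (λ c _ → All.universal ∈-allFin c) count≤)
  where
  length-allFin : length (allFin q) ≡ q
  length-allFin = LP.length-tabulate (λ i → i)

T-≟∧≟ : ∀ i j k l → T (does (i ℤ.≟ j) ∧ does (k ℤ.≟ l)) → i ≡ j × k ≡ l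
T-≟∧≟ i j k l test with i ℤ.≟ j | k ℤ.≟ l
... | yes i≡j | yes k≡l = i≡j , k≡l
... | yes _   | no _    = ⊥-elim test
... | no _    | _       = ⊥-elim test

Crosses : ℤ.ℤ → ℤ.ℤ → ℤ.ℤ → Set
Crosses h h′ x = (h ≡ x ℤ.- + 1 × h′ ≡ x) ⊎ (h ≡ x × h′ ≡ x ℤ.- + 1)

no-back-and-forth : ∀ x y → x ℤ.- + 1 ≡ y → y ℤ.- + 1 ≢ x
no-back-and-forth x y refl back = -2≢0 (begin
  ℤ.-[1+ 1 ]                    ≡⟨ twice-left x ⟨
  (x ℤ.- + 1) ℤ.- + 1 ℤ.- x     ≡⟨ cong (ℤ._- x) back ⟩
  x ℤ.- x                       ≡⟨ ℤP.+-inverseʳ x ⟩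
  + 0 ∎)
  where
  open ≡-Reasoning
  twice-left : ∀ x → (x ℤ.- + 1) ℤ.- + 1 ℤ.- x ≡ ℤ.-[1+ 1 ]
  twice-left = ℤ-Solver.solve-∀
  -2≢0 : ℤ.-[1+ 1 ] ≢ + 0
  -2≢0 ()

crosses-unique : ∀ {h h′ x y} → Crosses h h′ x → Crosses h h′ y → x ≡ y
crosses-unique (inj₁ (_ , refl)) (inj₁ (_ , refl)) = refl
crosses-unique (inj₂ (refl , _)) (inj₂ (refl , _)) = refl
crosses-unique {x = x} {y} (inj₁ (h≡ , h′≡)) (inj₂ (h≡′ , h′≡′)) =
  ⊥-elim (no-back-and-forth x y (trans (sym h≡) h≡′) (trans (sym h′≡′) h′≡))
crosses-unique {x = x} {y} (inj₂ (h≡ , h′≡)) (inj₁ (h≡′ , h′≡′)) =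
  ⊥-elim (no-back-and-forth y x (trans (sym h≡′) h≡) (trans (sym h′≡) h′≡′))

-- range n = 1 ∷ 2 ∷ … ∷ n, built by appending like crossingSeqs
range : ℕ → List ℕ
range zero    = []
range (suc n) = range n ++ [ suc n ]

length-range : ∀ n → length (range n) ≡ n
length-range zero    = refl
length-range (suc n) =
  trans (LP.length-++ (range n)) (trans (+-comm (length (range n)) 1) (cong suc (length-range n)))

∈-range : ∀ n {i} → i ∈ range n → 1 ≤ i × i ≤ n
∈-range (suc n) i∈ with ∈-++⁻ (range n) i∈
... | inj₁ i∈n = let 1≤i , i≤n = ∈-range n i∈n in 1≤i , m≤n⇒m≤1+n i≤n
... | inj₂ (here refl) = s≤s z≤n , ≤-refl

∑-indicator-unique : ∀ (b : ℕ → Bool) → (∀ {i j} → T (b i) → T (b j) → i ≡ j) →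
  ∀ n → ∑ (indicator ∘ b) (range n) ≤ 1
∑-indicator-unique b unique zero    = z≤n
∑-indicator-unique b unique (suc n) rewrite ∑-++ (indicator ∘ b) (range n) [ suc n ]
  with b (suc n) in b[n+1]
... | false = subst (_≤ 1) (sym (+-identityʳ _)) (∑-indicator-unique b unique n)
... | true  = subst (λ m → m + 1 ≤ 1) (sym (n≤0⇒n≡0 earlier≤0)) ≤-refl
  where
  earlier-false : ∀ i → i ∈ range n → indicator (b i) ≤ 0
  earlier-false i i∈ with b i in b[i]
  ... | false = z≤n
  ... | true  = ⊥-elim (<-irrefl (unique (subst T (sym b[i]) tt) (subst T (sym b[n+1]) tt))
                                 (s≤s (let _ , i≤n = ∈-range n i∈ in i≤n)))
  earlier≤0 : ∑ (indicator ∘ b) (range n) ≤ 0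
  earlier≤0 = ≤-trans (∑-mono (range n) earlier-false) (≤-reflexive (∑-zero (range n)))

module CrossingCount (M : NTM) (ζ : ℕ → Config M) where

  crossesAt-sound : ∀ x s → T (crossesAt M ζ x s) → Crosses (head (ζ s)) (head (ζ (suc s))) x
  crossesAt-sound x s crossing =
    Sum.map (T-≟∧≟ h (x ℤ.- + 1) h′ x) (T-≟∧≟ h x h′ (x ℤ.- + 1))
            (to (T-∨ {test h (x ℤ.- + 1) ∧ test h′ x} {test h x ∧ test h′ (x ℤ.- + 1)}) crossing)
    where
    h h′ : ℤ.ℤ
    h  = head (ζ s)
    h′ = head (ζ (suc s))
    test : ℤ.ℤ → ℤ.ℤ → Bool
    test i j = does (i ℤ.≟ j)

  length-if : ∀ {A : Set} b (y : A) → length (if b then [ y ] else []) ≡ indicator b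
  length-if true  _ = refl
  length-if false _ = refl

  length-crossingSeq-suc : ∀ s x →
    length (crossingSeq M ζ (suc s) x) ≡ length (crossingSeq M ζ s x) + indicator (crossesAt M ζ x s)
  length-crossingSeq-suc s x =
    trans (LP.length-++ (crossingSeq M ζ s x)) (cong (_+_ _) (length-if (crossesAt M ζ x s) _))

  total-crossings : ∀ n s → ∑ (λ i → length (crossingSeq M ζ s (+ i))) (range n) ≤ s
  total-crossings n zero    = ≤-reflexive (∑-zero (range n))
  total-crossings n (suc s) = begin
    ∑ (λ i → length (crossingSeq M ζ (suc s) (+ i))) (range n)
      ≤⟨ ∑-mono (range n) (λ i _ → ≤-reflexive (length-crossingSeq-suc s (+ i))) ⟩
    ∑ (λ i → length (crossingSeq M ζ s (+ i)) + indicator (crossesAt M ζ (+ i) s)) (range n)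
      ≡⟨ ∑-+ (λ i → length (crossingSeq M ζ s (+ i))) (λ i → indicator (crossesAt M ζ (+ i) s)) (range n) ⟩
    ∑ (λ i → length (crossingSeq M ζ s (+ i))) (range n) + ∑ (λ i → indicator (crossesAt M ζ (+ i) s)) (range n)
      ≤⟨ +-mono-≤ (total-crossings n s) (∑-indicator-unique (λ i → crossesAt M ζ (+ i) s) one-boundary n) ⟩
    s + 1
      ≡⟨ +-comm s 1 ⟩
    suc s ∎
    where
    open ≤-Reasoning
    one-boundary : ∀ {i j} → T (crossesAt M ζ (+ i) s) → T (crossesAt M ζ (+ j) s) → i ≡ j
    one-boundary i-crossed j-crossed =
      ℤP.+-injective (crosses-unique (crossesAt-sound _ s i-crossed) (crossesAt-sound _ s j-crossed))

  crossingSeqs-range : ∀ t n → crossingSeqs M ζ t n ≡ map (λ i → crossingSeq M ζ t (+ i)) (range n)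
  crossingSeqs-range t zero    = refl
  crossingSeqs-range t (suc n) =
    trans (cong (_++ [ crossingSeq M ζ t (+ suc n) ]) (crossingSeqs-range t n))
          (sym (LP.map-++ _ (range n) [ suc n ]))

  length-crossingSeqs : ∀ t n → length (crossingSeqs M ζ t n) ≡ n
  length-crossingSeqs t n = begin
    length (crossingSeqs M ζ t n)                             ≡⟨ cong length (crossingSeqs-range t n) ⟩
    length (map (λ i → crossingSeq M ζ t (+ i)) (range n))    ≡⟨ LP.length-map _ (range n) ⟩
    length (range n)                                          ≡⟨ length-range n ⟩
    n ∎
    where open ≡-Reasoning

  ∑-length-crossingSeqs : ∀ t n → ∑ length (crossingSeqs M ζ t n) ≤ t
  ∑-length-crossingSeqs t n = subst (_≤ t) (sym total≡) (total-crossings n t)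
    where
    total≡ : ∑ length (crossingSeqs M ζ t n) ≡ ∑ (λ i → length (crossingSeq M ζ t (+ i))) (range n)
    total≡ = trans (cong (∑ length) (crossingSeqs-range t n)) (∑-map length _ (range n))

  ∈-crossingSeqs : ∀ t n {c} → c ∈ crossingSeqs M ζ t n →
    ∃ λ i → 1 ≤ i × i ≤ n × c ≡ crossingSeq M ζ t (+ i)
  ∈-crossingSeqs t n c∈ with ∈-map⁻ _ (subst (_ ∈_) (crossingSeqs-range t n) c∈)
  ... | i , i∈ , c≡ = let 1≤i , i≤n = ∈-range n i∈ in i , 1≤i , i≤n , c≡

2≤states : ∀ M → 2 ≤ NTM.q M
2≤states M = distinct⇒2≤ (NTM.q₀≢acc M)
  where
  distinct⇒2≤ : ∀ {n} {a b : Fin n} → a ≢ b → 2 ≤ n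
  distinct⇒2≤ {suc zero}    {Fin.zero} {Fin.zero} a≢b = ⊥-elim (a≢b refl)
  distinct⇒2≤ {suc (suc n)} _                         = s≤s (s≤s z≤n)

lemma3 : (C D : ℕ) (M : NTM) (w : List (Fin (NTM.σ M))) (t k : ℕ)
    (ζ : ℕ → Config M) →
    IsRun M w t ζ →
    t ≤ C * length w + D →
    (∀ i → 1 ≤ i → i ≤ length w →
      occurrences M (crossingSeq M ζ t (+ i)) (crossingSeqs M ζ t (length w)) ≤ k) →
    length w ≤ D + 4 * k * NTM.q M ^ C
lemma3 C D M w t k ζ _ t≤Cn+D occurrences≤k = +-cancelʳ-≤ (C * n) n (D + 4 * k * q ^ C) (begin
  n + C * n                         ≡⟨ *-comm (suc C) n ⟩
  n * suc C                         ≡⟨ cong (_* suc C) (length-crossingSeqs t n) ⟨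
  length cs * suc C                 ≤⟨ length-plus-deficit C cs ⟩
  ∑ length cs + ∑ (deficit C) cs    ≤⟨ +-mono-≤ (≤-trans (∑-length-crossingSeqs t n) t≤Cn+D) deficit≤ ⟩
  C * n + D + 4 * k * q ^ C         ≡⟨ trans (+-assoc (C * n) D _) (+-comm (C * n) _) ⟩
  D + 4 * k * q ^ C + C * n ∎)
  where
  open ≤-Reasoning
  open CrossingCount M ζ
  q n : ℕ
  q = NTM.q M
  n = length w
  cs : List (List (Fin q))
  cs = crossingSeqs M ζ t n
  deficit≤ : ∑ (deficit C) cs ≤ 4 * k * q ^ C
  deficit≤ = ∑-deficit-bound-Fin (2≤states M) C k cs λ c c∈ →
    let i , 1≤i , i≤n , c≡ = ∈-crossingSeqs t n c∈ in
    subst (λ c′ → occurrences M c′ cs ≤ k) (sym c≡) (occurrences≤k i 1≤i i≤n)
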